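{- Let $\mathcal A_1=\langle Q_1,\Sigma,\Delta_1,\{q_1\}\rangle$ and $\mathcal A_2=\langle Q_2,\Sigma,\Delta_2,\{q_2\}\rangle$ be tagged TAs whose languages consist of tagged $n$-qubit trees, and assume that all leaf symbols of $\mathcal A_1$ and $\mathcal A_2$ have the same fifth component $k$. Let $\circ\in\{+,-\}$ and let $\mathsf{Bin}(\mathcal A_1,\mathcal A_2,\circ)$ be the TA with states $Q_1\times Q_2$, root state $(q_1,q_2)$, and transitions \begin{itemize} \item $(q^1,q^2)\xrightarrow{x_j^i}((q^1_l,q^2_l),(q^1_r,q^2_r))$ for all $q^1\xrightarrow{x_j^i}(q^1_l,q^1_r)\in\Delta_1$ and $q^2\xrightarrow{x_j^i}(q^2_l,q^2_r)\in\Delta_2$ (same symbol); \item $(q^1,q^2)\xrightarrow{(a_1\circ a_2,\,b_1\circ b_2,\,c_1\circ c_2,\,d_1\circ d_2,\,k)}()$ for all $q^1\xrightarrow{(a_1,b_1,c_1,d_1,k)}()\in\Delta_1$ and $q^2\xrightarrow{(a_2,b_2,c_2,d_2,k)}()\in\Delta_2$. \end{itemize} Then $\mathcal L(\mathsf{Bin}(\mathcal A_1,\mathcal A_2,\circ))=\{T_1\circ T_2\mid T_1\in\mathcal L(\mathcal A_1),\ T_2\in\mathcal L(\mathcal A_2),\ \mathrm{Tag}(T_1)=\mathrm{Tag}(T_2)\}$.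
   Context: Tree automata: a TA is $\mathcal A=\langle Q,\Sigma,\Delta,\mathcal R\rangle$ with finite state set $Q$, ranked alphabet $\Sigma$ of binary and constant symbols, root states $\mathcal R\subseteq Q$, and transitions internal $q\xrightarrow{f}(q_0,q_1)$ or leaf $q\xrightarrow{c}()$. It is assumed no state has leaf transitions with two different constants. A run on a binary tree labels each node with a state so that each leaf labelled $c$ with state $q$ has $q\xrightarrow{c}()\in\Delta$ and each internal node labelled $f$ with state $q$ and children states $q_0$ (left), $q_1$ (right) has $q\xrightarrow{f}(q_0,q_1)\in\Delta$; accepting if the root state is in $\mathcal R$; $\mathcal L(\mathcal A)$ is the set of trees with an accepting run. Leaf symbols are tuples $(a,b,c,d,k)\in\mathbb Z^5$ representing $(1/\sqrt2)^k(a+b\omega+c\omega^2+d\omega^3)$, $\omega=e^{i\pi/4}$. A tagged TA has binary symbols $x_k^j$ ($k$ qubit index, $j$ tag) with distinct internal transitions carrying distinct symbols. A tagged $n$-qubit tree is a full binary tree of height $n$ whose internal nodes at depth $k-1$ are labelled by symbols $x_k^j$ and whose leaves are labelled in $\mathbb Z^5$. $\mathrm{Tag}(T)$ replaces every leaf label by a special symbol $\square$. For trees $T_1,T_2$ with $\mathrm{Tag}(T_1)=\mathrm{Tag}(T_2)$, $T_1\pm T_2$ is the tree with the same internal labels whose leaf at each position is the sum/difference of the complex amplitudes of $T_1$ and $T_2$ at that position (for equal $k$, represented componentwise by $(a_1\pm a_2,b_1\pm b_2,c_1\pm c_2,d_1\pm d_2,k)$). -}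

module Defs where

open import Data.Nat using (ℕ; zero; suc)
open import Data.Integer using (ℤ) renaming (_+_ to _+ℤ_; _-_ to _-ℤ_)
open import Data.Product using (_×_; _,_; ∃; Σ-syntax; ∃-syntax)
open import Data.Product.Properties using (≡-dec)
open import Data.List using (List; []; _∷_; [_]; concatMap)
open import Data.List.Membership.Propositional using (_∈_)
open import Relation.Binary.PropositionalEquality using (_≡_)
open import Relation.Nullary using (does)
open import Data.Bool using (if_then_else_)
import Data.Nat as ℕ

-- Leaf symbols (a,b,c,d,k) ∈ ℤ⁵ representing (1/√2)^k (a + bω + cω² + dω³)
record Leaf : Set where
  constructor mkLeaf
  field
    a b c d k : ℤ
open Leaf public

-- Binary symbols x_k^j : (qubit index k , tag j)
Sym : Set
Sym = ℕ × ℕ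

qubit : Sym → ℕ
qubit (k , _) = k

data Tree : Set where
  leaf : Leaf → Tree
  node : Sym → Tree → Tree → Tree

-- Tree automaton with state type Q, finite transition lists and root states.
-- Internal transition (q , f , q₀ , q₁) means q -f-> (q₀ , q₁);
-- leaf transition (q , c) means q -c-> ().
record TA (Q : Set) : Set where
  field
    Δint  : List (Q × Sym × Q × Q)
    Δleaf : List (Q × Leaf)
    roots : List Q
open TA public

data Run {Q : Set} (A : TA Q) : Q → Tree → Set where
  run-leaf : ∀ {q c} → (q , c) ∈ Δleaf A → Run A q (leaf c)
  run-node : ∀ {q f q₀ q₁ l r} → (q , f , q₀ , q₁) ∈ Δint A →
             Run A q₀ l → Run A q₁ r → Run A q (node f l r)

Lang : {Q : Set} → TA Q → Tree → Set
Lang A T = ∃[ q ] (q ∈ roots A × Run A q T)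

LeafDet : {Q : Set} → TA Q → Set
LeafDet A = ∀ {q c c′} → (q , c) ∈ Δleaf A → (q , c′) ∈ Δleaf A → c ≡ c′

Tagged : {Q : Set} → TA Q → Set
Tagged A = ∀ {q f q₀ q₁ q′ q₀′ q₁′} →
  (q , f , q₀ , q₁) ∈ Δint A → (q′ , f , q₀′ , q₁′) ∈ Δint A →
  (q , f , q₀ , q₁) ≡ (q′ , f , q₀′ , q₁′)

IsQTree : ℕ → ℕ → Tree → Set
IsQTree k zero    (leaf _)       = Data.Unit.⊤ where import Data.Unit
IsQTree k zero    (node _ _ _)   = Data.Empty.⊥ where import Data.Empty
IsQTree k (suc h) (leaf _)       = Data.Empty.⊥ where import Data.Empty
IsQTree k (suc h) (node f l r)   = qubit f ≡ k × IsQTree (suc k) h l × IsQTree (suc k) h r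

-- tagged n-qubit tree: root at depth 0 labelled by x_1^j
TaggedNQubitTree : ℕ → Tree → Set
TaggedNQubitTree n T = IsQTree 1 n T

LeavesHaveK : {Q : Set} → TA Q → ℤ → Set
LeavesHaveK A k₀ = ∀ {q c} → (q , c) ∈ Δleaf A → k c ≡ k₀

data TagTree : Set where
  □ : TagTree
  tnode : Sym → TagTree → TagTree → TagTree

Tag : Tree → TagTree
Tag (leaf _) = □
Tag (node f l r) = tnode f (Tag l) (Tag r)

data Op : Set where
  plus minus : Op

opℤ : Op → ℤ → ℤ → ℤ
opℤ plus  = _+ℤ_
opℤ minus = _-ℤ_

opLeaf : Op → Leaf → Leaf → Leaf
opLeaf o (mkLeaf a₁ b₁ c₁ d₁ k₁) (mkLeaf a₂ b₂ c₂ d₂ _) =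
  mkLeaf (opℤ o a₁ a₂) (opℤ o b₁ b₂) (opℤ o c₁ c₂) (opℤ o d₁ d₂) k₁

-- T₁ ∘ T₂ (only meaningful when Tag T₁ ≡ Tag T₂; on shape mismatch returns T₁)
opTree : Op → Tree → Tree → Tree
opTree o (leaf c₁) (leaf c₂) = leaf (opLeaf o c₁ c₂)
opTree o (node f l₁ r₁) (node _ l₂ r₂) = node f (opTree o l₁ l₂) (opTree o r₁ r₂)
opTree o T₁ _ = T₁

_≟Sym_ : (f g : Sym) → Relation.Nullary.Dec (f ≡ g)
_≟Sym_ = ≡-dec ℕ._≟_ ℕ._≟_

Bin : {Q₁ Q₂ : Set} → TA Q₁ → TA Q₂ → Q₁ → Q₂ → Op → TA (Q₁ × Q₂)
Bin A₁ A₂ q₁ q₂ o = record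
  { Δint = concatMap (λ { (p₁ , f₁ , l₁ , r₁) → concatMap (λ { (p₂ , f₂ , l₂ , r₂) →
             if does (f₁ ≟Sym f₂) then [ ((p₁ , p₂) , f₁ , (l₁ , l₂) , (r₁ , r₂)) ] else [] })
             (Δint A₂) }) (Δint A₁)
  ; Δleaf = concatMap (λ { (p₁ , c₁) → concatMap (λ { (p₂ , c₂) →
             [ ((p₁ , p₂) , opLeaf o c₁ c₂) ] }) (Δleaf A₂) }) (Δleaf A₁)
  ; roots = [ (q₁ , q₂) ]
  }

-- The runs of Bin A₁ A₂ from (p₁ , p₂) are exactly the pairs of runs of A₁ from p₁
-- and of A₂ from p₂ on trees with the same tag, synchronised node by node; the
-- leaf they label in the product is the combined leaf.
module Submission where

open import Defs
open import Data.Nat using (ℕ)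
open import Data.Integer using (ℤ)
open import Data.Fin using (Fin)
open import Data.List using ([]; [_])
open import Data.List.Relation.Unary.Any using (here)
open import Data.List.Membership.Propositional using (_∈_; find; lose)
open import Data.List.Membership.Propositional.Properties using (∈-concatMap⁺; ∈-concatMap⁻)
open import Data.Product using (_×_; _,_; proj₁; proj₂; ∃-syntax)
open import Data.Bool using (if_then_else_)
open import Relation.Nullary using (does; yes; no)
open import Relation.Binary.PropositionalEquality using (_≡_; refl; cong₂)
open import Function.Bundles using (_⇔_; mk⇔)
open import Data.Empty using (⊥-elim)

∈-if-≟Sym⁻ : ∀ {A : Set} {y z : A} (f g : Sym) →
  y ∈ (if does (f ≟Sym g) then [ z ] else []) → f ≡ g × y ≡ z
∈-if-≟Sym⁻ f g y∈ with f ≟Sym g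
∈-if-≟Sym⁻ f g (here refl) | yes f≡g = f≡g , refl

∈-if-≟Sym-refl⁺ : ∀ {A : Set} {z : A} (f : Sym) →
  z ∈ (if does (f ≟Sym f) then [ z ] else [])
∈-if-≟Sym-refl⁺ f with f ≟Sym f
... | yes _ = here refl
... | no f≢f = ⊥-elim (f≢f refl)

tnode-injective : ∀ {f g l₁ r₁ l₂ r₂} → tnode f l₁ r₁ ≡ tnode g l₂ r₂ →
  f ≡ g × l₁ ≡ l₂ × r₁ ≡ r₂
tnode-injective refl = refl , refl , refl

module BinRuns {Q₁ Q₂ : Set} (A₁ : TA Q₁) (A₂ : TA Q₂) (q₁ : Q₁) (q₂ : Q₂) (o : Op) where

  private
    B : TA (Q₁ × Q₂)
    B = Bin A₁ A₂ q₁ q₂ o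

  Δleaf-Bin⁺ : ∀ {p₁ p₂ c₁ c₂} → (p₁ , c₁) ∈ Δleaf A₁ → (p₂ , c₂) ∈ Δleaf A₂ →
    ((p₁ , p₂) , opLeaf o c₁ c₂) ∈ Δleaf B
  Δleaf-Bin⁺ c₁∈ c₂∈ = ∈-concatMap⁺ _ (lose c₁∈ (∈-concatMap⁺ _ (lose c₂∈ (here refl))))

  Δleaf-Bin⁻ : ∀ {s c} → (s , c) ∈ Δleaf B →
    ∃[ c₁ ] ∃[ c₂ ] ((proj₁ s , c₁) ∈ Δleaf A₁ × (proj₂ s , c₂) ∈ Δleaf A₂ ×
                     c ≡ opLeaf o c₁ c₂)
  Δleaf-Bin⁻ c∈ with find (∈-concatMap⁻ _ {xs = Δleaf A₁} c∈)
  ... | (_ , c₁) , c₁∈ , c∈′ with find (∈-concatMap⁻ _ {xs = Δleaf A₂} c∈′)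
  ... | (_ , c₂) , c₂∈ , here refl = c₁ , c₂ , c₁∈ , c₂∈ , refl

  Δint-Bin⁺ : ∀ {p₁ p₂ f l₁ l₂ r₁ r₂} →
    (p₁ , f , l₁ , r₁) ∈ Δint A₁ → (p₂ , f , l₂ , r₂) ∈ Δint A₂ →
    ((p₁ , p₂) , f , (l₁ , l₂) , (r₁ , r₂)) ∈ Δint B
  Δint-Bin⁺ {f = f} t₁∈ t₂∈ =
    ∈-concatMap⁺ _ (lose t₁∈ (∈-concatMap⁺ _ (lose t₂∈ (∈-if-≟Sym-refl⁺ f))))

  Δint-Bin⁻ : ∀ {s f sl sr} → (s , f , sl , sr) ∈ Δint B →
    (proj₁ s , f , proj₁ sl , proj₁ sr) ∈ Δint A₁ × (proj₂ s , f , proj₂ sl , proj₂ sr) ∈ Δint A₂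
  Δint-Bin⁻ t∈ with find (∈-concatMap⁻ _ {xs = Δint A₁} t∈)
  ... | (_ , f₁ , _ , _) , t₁∈ , t∈′ with find (∈-concatMap⁻ _ {xs = Δint A₂} t∈′)
  ... | (_ , f₂ , _ , _) , t₂∈ , t∈″ with ∈-if-≟Sym⁻ f₁ f₂ t∈″
  ... | refl , refl = t₁∈ , t₂∈

  Run-Bin⁻ : ∀ {s T} → Run B s T →
    ∃[ T₁ ] ∃[ T₂ ] (Run A₁ (proj₁ s) T₁ × Run A₂ (proj₂ s) T₂ ×
                     Tag T₁ ≡ Tag T₂ × T ≡ opTree o T₁ T₂)
  Run-Bin⁻ (run-leaf c∈) with Δleaf-Bin⁻ c∈
  ... | c₁ , c₂ , c₁∈ , c₂∈ , refl =
    leaf c₁ , leaf c₂ , run-leaf c₁∈ , run-leaf c₂∈ , refl , refl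
  Run-Bin⁻ (run-node t∈ ρl ρr)
    with Δint-Bin⁻ t∈ | Run-Bin⁻ ρl | Run-Bin⁻ ρr
  ... | t₁∈ , t₂∈ | l₁ , l₂ , ρl₁ , ρl₂ , tagl , refl | r₁ , r₂ , ρr₁ , ρr₂ , tagr , refl =
    node _ l₁ r₁ , node _ l₂ r₂ , run-node t₁∈ ρl₁ ρr₁ , run-node t₂∈ ρl₂ ρr₂ ,
    cong₂ (tnode _) tagl tagr , refl

  Run-Bin⁺ : ∀ {p₁ p₂ T₁ T₂} → Run A₁ p₁ T₁ → Run A₂ p₂ T₂ → Tag T₁ ≡ Tag T₂ →
    Run B (p₁ , p₂) (opTree o T₁ T₂)
  Run-Bin⁺ (run-leaf c₁∈) (run-leaf c₂∈) _ = run-leaf (Δleaf-Bin⁺ c₁∈ c₂∈)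
  Run-Bin⁺ (run-node t₁∈ ρl₁ ρr₁) (run-node t₂∈ ρl₂ ρr₂) tag≡ with tnode-injective tag≡
  ... | refl , tagl , tagr =
    run-node (Δint-Bin⁺ t₁∈ t₂∈) (Run-Bin⁺ ρl₁ ρl₂ tagl) (Run-Bin⁺ ρr₁ ρr₂ tagr)
  Run-Bin⁺ (run-leaf _) (run-node _ _ _) ()
  Run-Bin⁺ (run-node _ _ _) (run-leaf _) ()

theorem6p12 : (n m₁ m₂ : ℕ) (A₁ : TA (Fin m₁)) (A₂ : TA (Fin m₂))
    (q₁ : Fin m₁) (q₂ : Fin m₂) →
    roots A₁ ≡ [ q₁ ] → roots A₂ ≡ [ q₂ ] →
    Tagged A₁ → Tagged A₂ → LeafDet A₁ → LeafDet A₂ →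
    (∀ T → Lang A₁ T → TaggedNQubitTree n T) →
    (∀ T → Lang A₂ T → TaggedNQubitTree n T) →
    (k₀ : ℤ) → LeavesHaveK A₁ k₀ → LeavesHaveK A₂ k₀ →
    (o : Op) → (T : Tree) →
    Lang (Bin A₁ A₂ q₁ q₂ o) T ⇔
      (∃[ T₁ ] ∃[ T₂ ] (Lang A₁ T₁ × Lang A₂ T₂ × Tag T₁ ≡ Tag T₂ × T ≡ opTree o T₁ T₂))
theorem6p12 _ _ _ A₁ A₂ q₁ q₂ roots₁ roots₂ _ _ _ _ _ _ _ _ _ o _ = mk⇔ to from
  where
  open BinRuns A₁ A₂ q₁ q₂ o

  to : ∀ {T} → Lang (Bin A₁ A₂ q₁ q₂ o) T →
    ∃[ T₁ ] ∃[ T₂ ] (Lang A₁ T₁ × Lang A₂ T₂ × Tag T₁ ≡ Tag T₂ × T ≡ opTree o T₁ T₂)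
  to (_ , here refl , ρ) with Run-Bin⁻ ρ
  ... | T₁ , T₂ , ρ₁ , ρ₂ , tag≡ , T≡ rewrite roots₁ | roots₂ =
    T₁ , T₂ , (q₁ , here refl , ρ₁) , (q₂ , here refl , ρ₂) , tag≡ , T≡

  from : ∀ {T} →
    ∃[ T₁ ] ∃[ T₂ ] (Lang A₁ T₁ × Lang A₂ T₂ × Tag T₁ ≡ Tag T₂ × T ≡ opTree o T₁ T₂) →
    Lang (Bin A₁ A₂ q₁ q₂ o) T
  from (_ , _ , (p₁ , p₁∈ , ρ₁) , (p₂ , p₂∈ , ρ₂) , tag≡ , refl) rewrite roots₁ | roots₂
    with p₁∈ | p₂∈
  ... | here refl | here refl = (q₁ , q₂) , here refl , Run-Bin⁺ ρ₁ ρ₂ tag≡
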